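{- Let $S$ be a finite non-empty set with $n$ elements, and let $p:S\to\mathbb{R}_{\ge 0}$; for $A\subseteq S$ write $p(A)=\sum_{i\in A}p(i)$. (1) For any execution of the Huffman algorithm on $(S,p)$, producing $F_0\subset F_1\subset\dots\subset F_{n-1}$, define partitions $\Pi_0,\dots,\Pi_{n-1}$ of $S$ by letting $\Pi_0$ be the partition into singletons and, for $1\le k\le n-1$, letting $\Pi_k$ be obtained from $\Pi_{k-1}$ by replacing with the only set $C\in F_k\setminus F_{k-1}$ the two classes $A,B$ of $\Pi_{k-1}$ for which $C=A\cup B$. Then $\Pi_0<\Pi_1<\dots<\Pi_{n-1}$ is a maximal chain in the lattice of partitions of $S$. (2) A maximal chain $\Pi_0<\Pi_1<\dots<\Pi_{n-1}$ in the lattice of partitions of $S$ corresponds (in the sense of (1)) to an execution of the Huffman algorithm if and only if for each $1\le k\le n-1$ the uniquely determined class $C\in\Pi_k\setminus\Pi_{k-1}$ satisfies $p(C)\le p(D)$ for every set $D\in\Pi\setminus\Pi_{k-1}$, for all partitions $\Pi$ covering $\Pi_{k-1}$ in the partition lattice.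
   Context: The lattice of partitions of $S$ is ordered by refinement, finer partitions being smaller; a partition $\Pi$ covers $\Pi'$ exactly when $\Pi$ is obtained from $\Pi'$ by merging two distinct classes into their union. The Huffman algorithm on $(S,p)$ constructs a sequence of families of subsets of $S$ as follows: $F_0$ is the family of all singletons $\{i\}$, $i\in S$; while $S\notin F_k$, choose two distinct maximal (under inclusion) members $A,B$ of $F_k$ such that $p(A\cup B)$ is minimal over all choices of two distinct maximal members of $F_k$, and set $F_{k+1}=F_k\cup\{A\cup B\}$. The choices are arbitrary among minimizing pairs, so different executions are possible; each execution stops at stage $n-1$ with $S\in F_{n-1}$. -}

module Defs where

open import Level using (Level; 0ℓ)
open import Data.Nat using (ℕ; zero; suc; _<_; _≤_)
open import Data.Fin using (Fin; zero; suc)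
open import Data.Fin.Subset using (Subset; _∈_; _⊆_; _∪_; _∩_; ⊤; ⊥; ⁅_⁆; Nonempty)
open import Data.Vec using (_∷_; [])
open import Data.Bool using (Bool; true; false; if_then_else_)
open import Data.Product using (Σ; ∃; ∃-syntax; _×_; _,_)
open import Data.Sum using (_⊎_)
open import Relation.Nullary using (¬_)
open import Relation.Binary.PropositionalEquality using (_≡_; _≢_)
open import Algebra.Bundles using (CommutativeRing)
open import Relation.Binary.Structures using (IsTotalOrder)

infix 3 _⇔_
_⇔_ : ∀ {a b} → Set a → Set b → Set _
A ⇔ B = (A → B) × (B → A)

record RealNumbers : Set₁ where
  field
    commutativeRing : CommutativeRing 0ℓ 0ℓ
  open CommutativeRing commutativeRing public
  field
    _≤ℝ_        : Carrier → Carrier → Set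
    isTotalOrder : IsTotalOrder _≈_ _≤ℝ_
    +-mono       : ∀ {x y} z → x ≤ℝ y → (x + z) ≤ℝ (y + z)
    *-nonneg     : ∀ {x y} → 0# ≤ℝ x → 0# ≤ℝ y → 0# ≤ℝ (x * y)
    nontrivial   : ¬ (0# ≈ 1#)
    inverse      : ∀ x → ¬ (x ≈ 0#) → ∃[ y ] (x * y ≈ 1#)
    complete     : (P : Carrier → Set) → ∃ P →
                   (∃[ b ] (∀ x → P x → x ≤ℝ b)) →
                   ∃[ s ] ((∀ x → P x → x ≤ℝ s) ×
                           (∀ b → (∀ x → P x → x ≤ℝ b) → s ≤ℝ b))

Family : ℕ → Set₁
Family n = Subset n → Set

_≐_ : ∀ {n} → Family n → Family n → Set
P ≐ Q = ∀ X → P X ⇔ Q X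

MaxIn : ∀ {n} → Family n → Subset n → Set
MaxIn F A = F A × (∀ B → F B → A ⊆ B → A ≡ B)

Singletons : ∀ {n} → Family n
Singletons X = ∃[ i ] (X ≡ ⁅ i ⁆)

-- Partitions of S = Fin n (a partition is its family of classes).

IsPartition : ∀ {n} → Family n → Set
IsPartition {n} P =
  (∀ A → P A → Nonempty A) ×
  (∀ A B → P A → P B → A ≡ B ⊎ A ∩ B ≡ ⊥) ×
  (∀ (i : Fin n) → ∃[ A ] (P A × i ∈ A))

_≼_ : ∀ {n} → Family n → Family n → Set
P ≼ Q = ∀ A → P A → ∃[ B ] (Q B × A ⊆ B)

_≺_ : ∀ {n} → Family n → Family n → Set
P ≺ Q = P ≼ Q × ¬ (P ≐ Q)

Merge : ∀ {n} → Family n → Subset n → Subset n → Family n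
Merge P A B X = (P X × X ≢ A × X ≢ B) ⊎ X ≡ A ∪ B

Covers : ∀ {n} → Family n → Family n → Set
Covers Q P = ∃[ A ] ∃[ B ] (P A × P B × A ≢ B × Q ≐ Merge P A B)

-- Π 0 < Π 1 < ... < Π m is a maximal chain in the partition lattice
-- (only the indices 0..m of the sequence are relevant)
record IsMaximalChain {n} (m : ℕ) (Π : ℕ → Family n) : Set₁ where
  field
    partitions : ∀ k → k ≤ m → IsPartition (Π k)
    increasing : ∀ k → k < m → Π k ≺ Π (suc k)
    maximal    : ∀ Q → IsPartition Q →
                 (∀ k → k ≤ m → Q ≼ Π k ⊎ Π k ≼ Q) →
                 ∃[ k ] (k ≤ m × Q ≐ Π k)

record Corresponds {n} (m : ℕ) (F Π : ℕ → Family n) : Set₁ where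
  field
    base : Π 0 ≐ Singletons
    step : ∀ k → k < m →
           ∃[ C ] ∃[ A ] ∃[ B ]
             (F (suc k) C × ¬ F k C × Π k A × Π k B × A ≢ B ×
              C ≡ A ∪ B × Π (suc k) ≐ Merge (Π k) A B)

module Huffman (ℝ : RealNumbers) where
  open RealNumbers ℝ using (Carrier; 0#; _+_; _≤ℝ_)

  weight : ∀ {n} → (Fin n → Carrier) → Subset n → Carrier
  weight {zero}  p []      = 0#
  weight {suc n} p (b ∷ A) =
    (if b then p zero else 0#) + weight (λ i → p (suc i)) A

  record HuffmanExecution {m : ℕ} (p : Fin (suc m) → Carrier)
                          (F : ℕ → Family (suc m)) : Set₁ where
    field
      init  : F 0 ≐ Singletons
      step  : ∀ k → k < m →
              ¬ F k ⊤ ×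
              ∃[ A ] ∃[ B ]
                (MaxIn (F k) A × MaxIn (F k) B × A ≢ B ×
                 (∀ A' B' → MaxIn (F k) A' → MaxIn (F k) B' → A' ≢ B' →
                    weight p (A ∪ B) ≤ℝ weight p (A' ∪ B')) ×
                 (F (suc k) ≐ λ X → F k X ⊎ X ≡ A ∪ B))
      stop  : F m ⊤

  HuffmanCondition : ∀ {m} → (Fin (suc m) → Carrier) →
                     (ℕ → Family (suc m)) → Set₁
  HuffmanCondition {m} p Π =
    ∀ k → k < m → ∀ C → Π (suc k) C → ¬ Π k C →
    ∀ Q → IsPartition Q → Covers Q (Π k) →
    ∀ D → Q D → ¬ Π k D → weight p C ≤ℝ weight p D

-- The family F k produced by k Huffman steps is a forest whose maximal members
-- partition S, and a step replaces the two chosen maximal members by their union.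
-- So Π k is the partition of S into the maximal members of F k, each step merges two
-- classes, and Π m = {S} since S ∈ F m.  A chain that starts at the singletons, merges
-- two classes at each step and ends at {S} is maximal, because the only partitions
-- between P and P with two classes merged are these two.  Conversely every maximal chain
-- is of this form, and Π k is the set of maximal members of ⋃_{j ≤ k} Π j; hence the
-- Huffman choice rule, which ranges over pairs of maximal members, is exactly the
-- condition of (2) on the partitions covering Π k.

module Submission where

open import Data.Nat using (ℕ; zero; suc; _≤_; _<_; z≤n; s≤s; _≤?_)
open import Data.Nat.Properties using (≤-refl; <⇒≤; ≰⇒>; m≤n⇒m<n∨m≡n; m≤n⇒m≤1+n)
open import Data.Fin using (Fin)
open import Data.Fin.Properties using (_≟_; all?; any?; ¬∀⟶∃¬)
open import Data.Fin.Subset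
  using (Subset; _∈_; _∉_; _⊆_; _⊈_; _∪_; _∩_; ⊤; ⁅_⁆; Nonempty)
  renaming (⊥ to ∅)
open import Data.Fin.Subset.Properties
  using (_∈?_; _⊆?_; ∈⊤; ⊆⊤; ∉⊥; x∈⁅x⁆; x∈⁅y⁆⇒x≡y; x∈p∩q⁺; x∈p∩q⁻; x∈p∪q⁻; p⊆p∪q; q⊆p∪q;
         ⊆-antisym; ⊆-reflexive; ⊆-trans; Empty-unique)
import Data.Vec.Properties as Vec
import Data.Bool.Properties as Bool
open import Data.Product using (∃; ∃-syntax; _×_; _,_; proj₁; proj₂)
open import Data.Sum using (_⊎_; inj₁; inj₂; [_,_])
open import Data.Empty using (⊥; ⊥-elim)
open import Function using (_∘_; id)
open import Relation.Nullary using (¬_; Dec; yes; no)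
open import Relation.Nullary.Decidable using (_×-dec_; ¬?; decidable-stable)
open import Relation.Binary.PropositionalEquality
  using (_≡_; _≢_; refl; sym; trans; subst; subst₂)
open import Defs

private variable
  n m : ℕ
  P Q R G G' : Family n
  A B X Y Z : Subset n
  x : Fin n

_≟ˢ_ : (X Y : Subset n) → Dec (X ≡ Y)
_≟ˢ_ = Vec.≡-dec Bool._≟_

∪-⊆ : A ⊆ X → B ⊆ X → A ∪ B ⊆ X
∪-⊆ {A = A} {B = B} A⊆X B⊆X x∈A∪B = [ A⊆X , B⊆X ] (x∈p∪q⁻ A B x∈A∪B)

⊈⇒∃∈∉ : X ⊈ Y → ∃[ x ] (x ∈ X × x ∉ Y)
⊈⇒∃∈∉ {X = X} {Y = Y} X⊈Y with any? (λ x → x ∈? X ×-dec ¬? (x ∈? Y))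
... | yes witness = witness
... | no none = ⊥-elim (X⊈Y λ {x} x∈X → decidable-stable (x ∈? Y) (λ x∉Y → none (x , x∈X , x∉Y)))

-- Partitions and refinement

≐-sym : P ≐ Q → Q ≐ P
≐-sym P≐Q X = proj₂ (P≐Q X) , proj₁ (P≐Q X)

≐-trans : P ≐ Q → Q ≐ R → P ≐ R
≐-trans P≐Q Q≐R X = proj₁ (Q≐R X) ∘ proj₁ (P≐Q X) , proj₂ (P≐Q X) ∘ proj₂ (Q≐R X)

≼-refl : P ≼ P
≼-refl A pA = A , pA , λ x∈A → x∈A

≼-trans : P ≼ Q → Q ≼ R → P ≼ R
≼-trans P≼Q Q≼R A pA with P≼Q A pA
... | B , qB , A⊆B with Q≼R B qB
... | C , rC , B⊆C = C , rC , ⊆-trans A⊆B B⊆C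

≐⇒≼ : P ≐ Q → P ≼ Q
≐⇒≼ P≐Q A pA = A , proj₁ (P≐Q A) pA , λ x∈A → x∈A

isPartition-resp-≐ : P ≐ Q → IsPartition P → IsPartition Q
isPartition-resp-≐ P≐Q (nonempty , disjoint , covering) =
  (λ A qA → nonempty A (proj₂ (P≐Q A) qA)) ,
  (λ A B qA qB → disjoint A B (proj₂ (P≐Q A) qA) (proj₂ (P≐Q B) qB)) ,
  (λ i → let (A , pA , i∈A) = covering i in A , proj₁ (P≐Q A) pA , i∈A)

module _ {n} {P : Family n} (π : IsPartition P) where

  class-nonempty : P A → Nonempty A
  class-nonempty = proj₁ π _

  classes-meet⇒≡ : P A → P B → x ∈ A → x ∈ B → A ≡ B
  classes-meet⇒≡ {A} {B} {x} pA pB x∈A x∈B with proj₁ (proj₂ π) A B pA pB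
  ... | inj₁ A≡B = A≡B
  ... | inj₂ A∩B≡∅ = ⊥-elim (∉⊥ (subst (x ∈_) A∩B≡∅ (x∈p∩q⁺ (x∈A , x∈B))))

  classOf : Fin n → Subset n
  classOf i = proj₁ (proj₂ (proj₂ π) i)

  classOf-class : ∀ i → P (classOf i)
  classOf-class i = proj₁ (proj₂ (proj₂ (proj₂ π) i))

  ∈-classOf : ∀ i → i ∈ classOf i
  ∈-classOf i = proj₂ (proj₂ (proj₂ (proj₂ π) i))

  ≡-classOf : P A → x ∈ A → A ≡ classOf x
  ≡-classOf pA x∈A = classes-meet⇒≡ pA (classOf-class _) x∈A (∈-classOf _)

  ⊤-class-unique : P ⊤ → P A → A ≡ ⊤
  ⊤-class-unique p⊤ pA with class-nonempty pA
  ... | x , x∈A = classes-meet⇒≡ pA p⊤ x∈A ∈⊤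

≼-class-⊆ : IsPartition Q → P ≼ Q → P A → Q B → x ∈ A → x ∈ B → A ⊆ B
≼-class-⊆ κ P≼Q pA qB x∈A x∈B with P≼Q _ pA
... | C , qC , A⊆C = ⊆-trans A⊆C (⊆-reflexive (classes-meet⇒≡ κ qC qB (A⊆C x∈A) x∈B))

≼-antisym : {P Q : Family n} → IsPartition P → IsPartition Q → P ≼ Q → Q ≼ P → P ≐ Q
≼-antisym {n} π κ P≼Q Q≼P X = upward π P≼Q Q≼P , upward κ Q≼P P≼Q
  where
  upward : {P Q : Family n} → IsPartition P → P ≼ Q → Q ≼ P → P X → Q X
  upward {Q = Q} π P≼Q Q≼P pX with P≼Q X pX
  ... | Y , qY , X⊆Y with Q≼P Y qY | class-nonempty π pX
  ... | Z , pZ , Y⊆Z | x , x∈X =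
    let Y⊆X = ⊆-trans Y⊆Z (⊆-reflexive (sym (classes-meet⇒≡ π pX pZ x∈X (Y⊆Z (X⊆Y x∈X)))))
    in subst Q (⊆-antisym Y⊆X X⊆Y) qY

singletons-isPartition : IsPartition (Singletons {n})
singletons-isPartition =
  (λ { _ (i , refl) → i , x∈⁅x⁆ i }) ,
  (λ { _ _ (i , refl) (j , refl) → singletons-disjoint i j }) ,
  (λ i → ⁅ i ⁆ , (i , refl) , x∈⁅x⁆ i)
  where
  singletons-disjoint : (i j : Fin n) → ⁅ i ⁆ ≡ ⁅ j ⁆ ⊎ ⁅ i ⁆ ∩ ⁅ j ⁆ ≡ ∅
  singletons-disjoint i j with i ≟ j
  ... | yes refl = inj₁ refl
  ... | no i≢j = inj₂ (Empty-unique λ { (x , x∈⁅i⁆∩⁅j⁆) →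
    let (x∈⁅i⁆ , x∈⁅j⁆) = x∈p∩q⁻ ⁅ i ⁆ ⁅ j ⁆ x∈⁅i⁆∩⁅j⁆
    in i≢j (trans (sym (x∈⁅y⁆⇒x≡y i x∈⁅i⁆)) (x∈⁅y⁆⇒x≡y j x∈⁅j⁆)) })

singletons-≼ : IsPartition P → Singletons ≼ P
singletons-≼ π _ (i , refl) =
  classOf π i , classOf-class π i , λ x∈⁅i⁆ → subst (_∈ classOf π i) (sym (x∈⁅y⁆⇒x≡y i x∈⁅i⁆)) (∈-classOf π i)

top-isPartition : IsPartition {suc n} (_≡ ⊤)
top-isPartition = (λ { _ refl → Fin.zero , ∈⊤ }) , (λ { _ _ refl refl → inj₁ refl }) , (λ i → ⊤ , refl , ∈⊤)

merge-resp-≐ : P ≐ Q → Merge P A B ≐ Merge Q A B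
merge-resp-≐ P≐Q X =
  (λ { (inj₁ (pX , X≢A , X≢B)) → inj₁ (proj₁ (P≐Q X) pX , X≢A , X≢B) ; (inj₂ X≡A∪B) → inj₂ X≡A∪B }) ,
  (λ { (inj₁ (qX , X≢A , X≢B)) → inj₁ (proj₂ (P≐Q X) qX , X≢A , X≢B) ; (inj₂ X≡A∪B) → inj₂ X≡A∪B })

merge-new-class : Merge P A B X → ¬ P X → X ≡ A ∪ B
merge-new-class (inj₁ (pX , _)) ¬pX = ⊥-elim (¬pX pX)
merge-new-class (inj₂ X≡A∪B) _ = X≡A∪B

module _ {n} {P : Family n} {A B : Subset n} (π : IsPartition P) (pA : P A) (pB : P B) (A≢B : A ≢ B) where

  no-class-⊇-∪ : P Z → A ∪ B ⊆ Z → ⊥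
  no-class-⊇-∪ pZ A∪B⊆Z with class-nonempty π pA | class-nonempty π pB
  ... | a , a∈A | b , b∈B =
    A≢B (trans (classes-meet⇒≡ π pA pZ a∈A (A∪B⊆Z (p⊆p∪q B a∈A)))
               (sym (classes-meet⇒≡ π pB pZ b∈B (A∪B⊆Z (q⊆p∪q A B b∈B)))))

  ∪-not-class : ¬ P (A ∪ B)
  ∪-not-class pA∪B = no-class-⊇-∪ pA∪B (λ x∈A∪B → x∈A∪B)

  merge-isPartition : IsPartition (Merge P A B)
  merge-isPartition = nonempty , disjoint , covering
    where
    disjoint-from-∪ : P X → X ≢ A → X ≢ B → x ∈ X → x ∉ A ∪ B
    disjoint-from-∪ pX X≢A X≢B x∈X x∈A∪B with x∈p∪q⁻ A B x∈A∪B
    ... | inj₁ x∈A = X≢A (classes-meet⇒≡ π pX pA x∈X x∈A)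
    ... | inj₂ x∈B = X≢B (classes-meet⇒≡ π pX pB x∈X x∈B)
    nonempty : ∀ X → Merge P A B X → Nonempty X
    nonempty X (inj₁ (pX , _)) = class-nonempty π pX
    nonempty X (inj₂ refl) with class-nonempty π pA
    ... | a , a∈A = a , p⊆p∪q B a∈A
    disjoint : ∀ X Y → Merge P A B X → Merge P A B Y → X ≡ Y ⊎ X ∩ Y ≡ ∅
    disjoint X Y (inj₁ (pX , _)) (inj₁ (pY , _)) = proj₁ (proj₂ π) X Y pX pY
    disjoint X Y (inj₁ (pX , X≢A , X≢B)) (inj₂ refl) = inj₂ (Empty-unique λ { (x , x∈X∩Y) →
      let (x∈X , x∈Y) = x∈p∩q⁻ X Y x∈X∩Y in disjoint-from-∪ pX X≢A X≢B x∈X x∈Y })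
    disjoint X Y (inj₂ refl) (inj₁ (pY , Y≢A , Y≢B)) = inj₂ (Empty-unique λ { (x , x∈X∩Y) →
      let (x∈X , x∈Y) = x∈p∩q⁻ X Y x∈X∩Y in disjoint-from-∪ pY Y≢A Y≢B x∈Y x∈X })
    disjoint X Y (inj₂ refl) (inj₂ refl) = inj₁ refl
    covering : ∀ i → ∃[ X ] (Merge P A B X × i ∈ X)
    covering i with classOf π i ≟ˢ A | classOf π i ≟ˢ B
    ... | yes refl | _ = A ∪ B , inj₂ refl , p⊆p∪q B (∈-classOf π i)
    ... | no _ | yes refl = A ∪ B , inj₂ refl , q⊆p∪q A B (∈-classOf π i)
    ... | no ≢A | no ≢B = classOf π i , inj₁ (classOf-class π i , ≢A , ≢B) , ∈-classOf π i

  ≼-merge : P ≼ Merge P A B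
  ≼-merge X pX with X ≟ˢ A | X ≟ˢ B
  ... | yes refl | _ = A ∪ B , inj₂ refl , p⊆p∪q B
  ... | no _ | yes refl = A ∪ B , inj₂ refl , q⊆p∪q A B
  ... | no X≢A | no X≢B = X , inj₁ (pX , X≢A , X≢B) , λ x∈X → x∈X

  merge-⋠ : ¬ (Merge P A B ≼ P)
  merge-⋠ merge≼P with merge≼P (A ∪ B) (inj₂ refl)
  ... | Z , pZ , A∪B⊆Z = no-class-⊇-∪ pZ A∪B⊆Z

  ≺-merge : P ≺ Merge P A B
  ≺-merge = ≼-merge , λ P≐merge → merge-⋠ (≐⇒≼ (≐-sym P≐merge))

  -- The case split: a ∈ A and b ∈ B lie either in one class of Q or in two.
  between-merge : IsPartition Q → P ≼ Q → Q ≼ Merge P A B → Q ≐ P ⊎ Q ≐ Merge P A B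
  between-merge {Q = Q} κ P≼Q Q≼M with class-nonempty π pA | class-nonempty π pB
  ... | a , a∈A | b , b∈B with classOf κ a ≟ˢ classOf κ b
  ... | yes Qa≡Qb = inj₂ (≼-antisym κ merge-isPartition Q≼M M≼Q)
    where
    M≼Q : Merge P A B ≼ Q
    M≼Q X (inj₁ (pX , _)) = P≼Q X pX
    M≼Q X (inj₂ refl) = classOf κ a , classOf-class κ a ,
      ∪-⊆ (≼-class-⊆ κ P≼Q pA (classOf-class κ a) a∈A (∈-classOf κ a))
          (⊆-trans (≼-class-⊆ κ P≼Q pB (classOf-class κ b) b∈B (∈-classOf κ b)) (⊆-reflexive (sym Qa≡Qb)))
  ... | no Qa≢Qb = inj₁ (≼-antisym κ π Q≼P P≼Q)
    where
    A⊆Qa : A ⊆ classOf κ a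
    A⊆Qa = ≼-class-⊆ κ P≼Q pA (classOf-class κ a) a∈A (∈-classOf κ a)
    B⊆Qb : B ⊆ classOf κ b
    B⊆Qb = ≼-class-⊆ κ P≼Q pB (classOf-class κ b) b∈B (∈-classOf κ b)
    Qa∩Qb-empty : x ∈ classOf κ a → x ∉ classOf κ b
    Qa∩Qb-empty x∈Qa x∈Qb = Qa≢Qb (classes-meet⇒≡ κ (classOf-class κ a) (classOf-class κ b) x∈Qa x∈Qb)
    inside-A-or-B : Q Y → Y ⊆ A ∪ B → Y ⊆ A ⊎ Y ⊆ B
    inside-A-or-B qY Y⊆A∪B with class-nonempty κ qY
    ... | y , y∈Y with x∈p∪q⁻ A B (Y⊆A∪B y∈Y)
    ... | inj₁ y∈A = inj₁ λ x∈Y → [ (λ x∈A → x∈A) , (λ x∈B → ⊥-elim (Qa∩Qb-empty (Y⊆Qa x∈Y) (B⊆Qb x∈B))) ]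
                                    (x∈p∪q⁻ A B (Y⊆A∪B x∈Y))
      where Y⊆Qa = ⊆-reflexive (classes-meet⇒≡ κ qY (classOf-class κ a) y∈Y (A⊆Qa y∈A))
    ... | inj₂ y∈B = inj₂ λ x∈Y → [ (λ x∈A → ⊥-elim (Qa∩Qb-empty (A⊆Qa x∈A) (Y⊆Qb x∈Y))) , (λ x∈B → x∈B) ]
                                    (x∈p∪q⁻ A B (Y⊆A∪B x∈Y))
      where Y⊆Qb = ⊆-reflexive (classes-meet⇒≡ κ qY (classOf-class κ b) y∈Y (B⊆Qb y∈B))
    Q≼P : Q ≼ P
    Q≼P Y qY with Q≼M Y qY
    ... | Z , inj₁ (pZ , _) , Y⊆Z = Z , pZ , Y⊆Z
    ... | Z , inj₂ refl , Y⊆A∪B with inside-A-or-B qY Y⊆A∪B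
    ... | inj₁ Y⊆A = A , pA , Y⊆A
    ... | inj₂ Y⊆B = B , pB , Y⊆B

-- Some class R i is not inside P i; merge P i with the class of a point j ∈ R i ∖ P i.
≺⇒merge-≼ : IsPartition P → IsPartition R → P ≺ R →
            ∃[ A ] ∃[ B ] (P A × P B × A ≢ B × Merge P A B ≼ R)
≺⇒merge-≼ {P = P} {R = R} π ρ (P≼R , P≉R) with all? (λ i → classOf ρ i ⊆? classOf π i)
... | yes R⊆P = ⊥-elim (P≉R (≼-antisym π ρ P≼R R≼P))
  where
  R≼P : R ≼ P
  R≼P Y rY with class-nonempty ρ rY
  ... | y , y∈Y = classOf π y , classOf-class π y , ⊆-trans (⊆-reflexive (≡-classOf ρ rY y∈Y)) (R⊆P y)
... | no R⊈P with ¬∀⟶∃¬ _ _ (λ i → classOf ρ i ⊆? classOf π i) R⊈P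
... | i , Ri⊈Pi with ⊈⇒∃∈∉ Ri⊈Pi
... | j , j∈Ri , j∉Pi =
  classOf π i , classOf π j , classOf-class π i , classOf-class π j , Pi≢Pj , merge≼R
  where
  Pi≢Pj : classOf π i ≢ classOf π j
  Pi≢Pj Pi≡Pj = j∉Pi (subst (j ∈_) (sym Pi≡Pj) (∈-classOf π j))
  merge≼R : Merge P (classOf π i) (classOf π j) ≼ R
  merge≼R X (inj₁ (pX , _)) = P≼R X pX
  merge≼R X (inj₂ refl) = classOf ρ i , classOf-class ρ i ,
    ∪-⊆ (≼-class-⊆ ρ P≼R (classOf-class π i) (classOf-class ρ i) (∈-classOf π i) (∈-classOf ρ i))
        (≼-class-⊆ ρ P≼R (classOf-class π j) (classOf-class ρ i) (∈-classOf π j) j∈Ri)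

-- Maximal chains are exactly the merge sequences reaching ⊤

record IsMergeSequence {n} (m : ℕ) (Π : ℕ → Family n) : Set where
  field
    base   : Π 0 ≐ Singletons
    merges : ∀ k → k < m → Covers (Π (suc k)) (Π k)

module _ {n m} {Π : ℕ → Family n} (ms : IsMergeSequence m Π) where
  open IsMergeSequence ms

  mergeSequence-partitions : ∀ k → k ≤ m → IsPartition (Π k)
  mergeSequence-partitions zero _ = isPartition-resp-≐ (≐-sym base) singletons-isPartition
  mergeSequence-partitions (suc k) k<m with merges k k<m
  ... | A , B , pA , pB , A≢B , Π≐merge =
    let π = mergeSequence-partitions k (<⇒≤ k<m)
    in isPartition-resp-≐ (≐-sym Π≐merge) (merge-isPartition π pA pB A≢B)

  mergeSequence⇒maximalChain : Π m ⊤ → IsMaximalChain m Π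
  mergeSequence⇒maximalChain Πm⊤ = record
    { partitions = mergeSequence-partitions ; increasing = increasing ; maximal = maximal }
    where
    increasing : ∀ k → k < m → Π k ≺ Π (suc k)
    increasing k k<m with merges k k<m
    ... | A , B , pA , pB , A≢B , Π≐merge =
      let (≼merge , ≉merge) = ≺-merge (mergeSequence-partitions k (<⇒≤ k<m)) pA pB A≢B
      in ≼-trans ≼merge (≐⇒≼ (≐-sym Π≐merge)) , λ Πk≐ → ≉merge (≐-trans Πk≐ Π≐merge)
    maximal : ∀ Q → IsPartition Q → (∀ k → k ≤ m → Q ≼ Π k ⊎ Π k ≼ Q) →
              ∃[ k ] (k ≤ m × Q ≐ Π k)
    maximal Q κ comparable = descend m ≤-refl (λ X _ → ⊤ , Πm⊤ , ⊆⊤)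
      where
      descend : ∀ k → k ≤ m → Q ≼ Π k → ∃[ l ] (l ≤ m × Q ≐ Π l)
      descend zero _ Q≼Π0 = 0 , z≤n ,
        ≼-antisym κ (mergeSequence-partitions 0 z≤n) Q≼Π0 (≼-trans (≐⇒≼ base) (singletons-≼ κ))
      descend (suc k) k<m Q≼Πsk with comparable k (<⇒≤ k<m) | merges k k<m
      ... | inj₁ Q≼Πk | _ = descend k (<⇒≤ k<m) Q≼Πk
      ... | inj₂ Πk≼Q | A , B , pA , pB , A≢B , Π≐merge
        with between-merge (mergeSequence-partitions k (<⇒≤ k<m)) pA pB A≢B κ Πk≼Q
               (≼-trans Q≼Πsk (≐⇒≼ Π≐merge))
      ... | inj₁ Q≐Πk = k , <⇒≤ k<m , Q≐Πk
      ... | inj₂ Q≐merge = suc k , k<m , ≐-trans Q≐merge (≐-sym Π≐merge)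

module _ {n m} {Π : ℕ → Family n} (mc : IsMaximalChain m Π) where
  open IsMaximalChain mc

  maximalChain-mono : ∀ j k → j ≤ k → k ≤ m → Π j ≼ Π k
  maximalChain-mono j zero z≤n _ = ≼-refl
  maximalChain-mono j (suc k) j≤sk k<m with m≤n⇒m<n∨m≡n j≤sk
  ... | inj₁ (s≤s j≤k) = ≼-trans (maximalChain-mono j k j≤k (<⇒≤ k<m)) (proj₁ (increasing k k<m))
  ... | inj₂ refl = ≼-refl

  maximalChain-∋ : IsPartition Q → (∀ R → IsPartition R → Q ≼ R ⊎ R ≼ Q) → ∃[ k ] (k ≤ m × Q ≐ Π k)
  maximalChain-∋ κ comparable = maximal _ κ (λ k k≤m → comparable (Π k) (partitions k k≤m))

  maximalChain⇒mergeSequence : IsMergeSequence m Π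
  maximalChain⇒mergeSequence = record { base = base ; merges = merges }
    where
    base : Π 0 ≐ Singletons
    base with maximalChain-∋ singletons-isPartition (λ R ρ → inj₁ (singletons-≼ ρ))
    ... | k , k≤m , singletons≐Πk =
      ≼-antisym (partitions 0 z≤n) singletons-isPartition
        (≼-trans (maximalChain-mono 0 k z≤n k≤m) (≐⇒≼ (≐-sym singletons≐Πk)))
        (singletons-≼ (partitions 0 z≤n))
    merges : ∀ k → k < m → Covers (Π (suc k)) (Π k)
    merges k k<m with ≺⇒merge-≼ (partitions k (<⇒≤ k<m)) (partitions (suc k) k<m) (increasing k k<m)
    ... | A , B , pA , pB , A≢B , merge≼Πsk = A , B , pA , pB , A≢B , ≼-antisym ρ μ Πsk≼merge merge≼Πsk
      where
      π = partitions k (<⇒≤ k<m)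
      ρ = partitions (suc k) k<m
      μ = merge-isPartition π pA pB A≢B
      comparable : ∀ l → l ≤ m → Merge (Π k) A B ≼ Π l ⊎ Π l ≼ Merge (Π k) A B
      comparable l l≤m with l ≤? k
      ... | yes l≤k = inj₂ (≼-trans (maximalChain-mono l k l≤k (<⇒≤ k<m)) (≼-merge π pA pB A≢B))
      ... | no l≰k = inj₁ (≼-trans merge≼Πsk (maximalChain-mono (suc k) l (≰⇒> l≰k) l≤m))
      Πsk≼merge : Π (suc k) ≼ Merge (Π k) A B
      Πsk≼merge with maximal _ μ comparable
      ... | l , l≤m , merge≐Πl with l ≤? k
      ... | yes l≤k = ⊥-elim (merge-⋠ π pA pB A≢B
                        (≼-trans (≐⇒≼ merge≐Πl) (maximalChain-mono l k l≤k (<⇒≤ k<m))))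
      ... | no l≰k = ≼-trans (maximalChain-mono (suc k) l (≰⇒> l≰k) l≤m) (≐⇒≼ (≐-sym merge≐Πl))

maximalChain-top : {Π : ℕ → Family (suc n)} → IsMaximalChain m Π → ∃[ k ] (k ≤ m × Π k ⊤)
maximalChain-top mc with maximalChain-∋ mc top-isPartition (λ R ρ → inj₂ λ X _ → ⊤ , refl , ⊆⊤)
... | k , k≤m , top≐Πk = k , k≤m , proj₁ (top≐Πk ⊤) refl

-- Families whose maximal members partition S

record Forest {n} (G : Family n) : Set where
  field
    roots-isPartition : IsPartition (MaxIn G)
    ⊆-root            : ∀ X → G X → ∃[ Y ] (MaxIn G Y × X ⊆ Y)

Adjoin : Family n → Subset n → Family n
Adjoin G C X = G X ⊎ X ≡ C

⊤-maxIn : G ⊤ → MaxIn G ⊤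
⊤-maxIn g⊤ = g⊤ , λ B _ ⊤⊆B → ⊆-antisym ⊤⊆B ⊆⊤

module _ {n} {P G : Family n} (π : IsPartition P) (P⊆G : ∀ X → P X → G X)
         (G≼P : ∀ X → G X → ∃[ Y ] (P Y × X ⊆ Y)) where

  maxIn-≐ : MaxIn G ≐ P
  maxIn-≐ X = maximal⇒class , class⇒maximal
    where
    maximal⇒class : MaxIn G X → P X
    maximal⇒class (gX , maximal) with G≼P X gX
    ... | Y , pY , X⊆Y = subst P (sym (maximal Y (P⊆G Y pY) X⊆Y)) pY
    class⇒maximal : P X → MaxIn G X
    class⇒maximal pX = P⊆G X pX , above
      where
      above : ∀ Z → G Z → X ⊆ Z → X ≡ Z
      above Z gZ X⊆Z with G≼P Z gZ | class-nonempty π pX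
      ... | Y , pY , Z⊆Y | x , x∈X =
        let X≡Y = classes-meet⇒≡ π pX pY x∈X (Z⊆Y (X⊆Z x∈X))
        in ⊆-antisym X⊆Z (⊆-trans Z⊆Y (⊆-reflexive (sym X≡Y)))

  forest-of-partition : Forest G
  forest-of-partition = record
    { roots-isPartition = isPartition-resp-≐ (≐-sym maxIn-≐) π
    ; ⊆-root = λ X gX → let (Y , pY , X⊆Y) = G≼P X gX in Y , proj₂ (maxIn-≐ Y) pY , X⊆Y }

singletons-forest : {G : Family n} → G ≐ Singletons → Forest G × MaxIn G ≐ Singletons
singletons-forest {n} {G} G≐singletons =
  forest-of-partition singletons-isPartition P⊆G G≼P , maxIn-≐ singletons-isPartition P⊆G G≼P
  where
  P⊆G : ∀ X → Singletons X → G X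
  P⊆G X = proj₂ (G≐singletons X)
  G≼P : ∀ X → G X → ∃[ Y ] (Singletons Y × X ⊆ Y)
  G≼P X gX = X , proj₁ (G≐singletons X) gX , λ x∈X → x∈X

∪-∉-maxIn : {G : Family n} {A B : Subset n} → MaxIn G A → MaxIn G B → A ≢ B → ¬ G (A ∪ B)
∪-∉-maxIn {A = A} {B} (_ , A-maximal) (_ , B-maximal) A≢B gA∪B =
  A≢B (trans (A-maximal _ gA∪B (p⊆p∪q B)) (sym (B-maximal _ gA∪B (q⊆p∪q A B))))

module _ {n} {G : Family n} {A B : Subset n} (φ : Forest G) (mA : MaxIn G A) (mB : MaxIn G B) (A≢B : A ≢ B) where
  open Forest φ

  forest-adjoin : G' ≐ Adjoin G (A ∪ B) → Forest G' × MaxIn G' ≐ Merge (MaxIn G) A B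
  forest-adjoin {G'} G'≐ =
    forest-of-partition μ merge⊆G' G'≼merge , maxIn-≐ μ merge⊆G' G'≼merge
    where
    μ = merge-isPartition roots-isPartition mA mB A≢B
    merge⊆G' : ∀ X → Merge (MaxIn G) A B X → G' X
    merge⊆G' X (inj₁ ((gX , _) , _)) = proj₂ (G'≐ X) (inj₁ gX)
    merge⊆G' X (inj₂ X≡A∪B) = proj₂ (G'≐ X) (inj₂ X≡A∪B)
    G'≼merge : ∀ X → G' X → ∃[ Y ] (Merge (MaxIn G) A B Y × X ⊆ Y)
    G'≼merge X g'X with proj₁ (G'≐ X) g'X
    ... | inj₂ X≡A∪B = X , inj₂ X≡A∪B , λ x∈X → x∈X
    ... | inj₁ gX with ⊆-root X gX
    ... | Y , mY , X⊆Y with ≼-merge roots-isPartition mA mB A≢B Y mY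
    ... | Z , mZ , Y⊆Z = Z , mZ , ⊆-trans X⊆Y Y⊆Z

adjoined-unique : G' ≐ Adjoin G Y → G' X → ¬ G X → X ≡ Y
adjoined-unique {G' = G'} {X = X} G'≐ g'X ¬gX with proj₁ (G'≐ X) g'X
... | inj₁ gX = ⊥-elim (¬gX gX)
... | inj₂ X≡Y = X≡Y

Lockstep : ℕ → (F Π : ℕ → Family n) → Set
Lockstep m F Π = ∀ k → k < m → ∃[ A ] ∃[ B ]
  (Π k A × Π k B × A ≢ B × Π (suc k) ≐ Merge (Π k) A B × F (suc k) ≐ Adjoin (F k) (A ∪ B))

module _ {n m} {F Π : ℕ → Family n} (F-base : F 0 ≐ Singletons) (Π-base : Π 0 ≐ Singletons)
         (lockstep : Lockstep m F Π) where

  lockstep-roots : ∀ k → k ≤ m → Forest (F k) × Π k ≐ MaxIn (F k)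
  lockstep-roots zero _ =
    let (φ , roots≐) = singletons-forest F-base in φ , ≐-trans Π-base (≐-sym roots≐)
  lockstep-roots (suc k) k<m with lockstep-roots k (<⇒≤ k<m) | lockstep k k<m
  ... | φ , Π≐roots | A , B , pA , pB , A≢B , Π≐merge , F≐ =
    let (φ' , roots≐merge) = forest-adjoin φ (proj₁ (Π≐roots A) pA) (proj₁ (Π≐roots B) pB) A≢B F≐
    in φ' , ≐-trans Π≐merge (≐-trans (merge-resp-≐ Π≐roots) (≐-sym roots≐merge))

  lockstep-corresponds : Corresponds m F Π
  lockstep-corresponds = record { base = Π-base ; step = step }
    where
    step : ∀ k → k < m → ∃[ C ] ∃[ A ] ∃[ B ]
             (F (suc k) C × ¬ F k C × Π k A × Π k B × A ≢ B × C ≡ A ∪ B × Π (suc k) ≐ Merge (Π k) A B)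
    step k k<m with lockstep k k<m
    ... | A , B , pA , pB , A≢B , Π≐merge , F≐ =
      let Π≐roots = proj₂ (lockstep-roots k (<⇒≤ k<m)) in
      A ∪ B , A , B , proj₂ (F≐ _) (inj₂ refl) ,
      ∪-∉-maxIn (proj₁ (Π≐roots A) pA) (proj₁ (Π≐roots B) pB) A≢B ,
      pA , pB , A≢B , refl , Π≐merge

ClassesUpTo : (ℕ → Family n) → ℕ → Family n
ClassesUpTo Π k X = ∃[ j ] (j ≤ k × Π j X)

module _ {n m} {Π : ℕ → Family n} (ms : IsMergeSequence m Π) where
  open IsMergeSequence ms

  classesUpTo-base : ClassesUpTo Π 0 ≐ Singletons
  classesUpTo-base X = (λ { (zero , z≤n , Π0X) → proj₁ (base X) Π0X }) , λ sX → 0 , z≤n , proj₂ (base X) sX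

  classesUpTo-lockstep : Lockstep m (ClassesUpTo Π) Π
  classesUpTo-lockstep k k<m with merges k k<m
  ... | A , B , pA , pB , A≢B , Π≐merge = A , B , pA , pB , A≢B , Π≐merge , grows
    where
    grows : ClassesUpTo Π (suc k) ≐ Adjoin (ClassesUpTo Π k) (A ∪ B)
    grows X = old-or-new , λ { (inj₁ (j , j≤k , ΠjX)) → j , m≤n⇒m≤1+n j≤k , ΠjX
                             ; (inj₂ X≡A∪B) → suc k , ≤-refl , proj₂ (Π≐merge X) (inj₂ X≡A∪B) }
      where
      old-or-new : ClassesUpTo Π (suc k) X → Adjoin (ClassesUpTo Π k) (A ∪ B) X
      old-or-new (j , j≤sk , ΠjX) with m≤n⇒m<n∨m≡n j≤sk
      ... | inj₁ (s≤s j≤k) = inj₁ (j , j≤k , ΠjX)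
      ... | inj₂ refl with proj₁ (Π≐merge X) ΠjX
      ...   | inj₁ (ΠkX , _) = inj₁ (k , ≤-refl , ΠkX)
      ...   | inj₂ X≡A∪B = inj₂ X≡A∪B

  classesUpTo-roots : ∀ k → k ≤ m → Π k ≐ MaxIn (ClassesUpTo Π k)
  classesUpTo-roots k k≤m = proj₂ (lockstep-roots classesUpTo-base base classesUpTo-lockstep k k≤m)

  classesUpTo-corresponds : Corresponds m (ClassesUpTo Π) Π
  classesUpTo-corresponds = lockstep-corresponds classesUpTo-base base classesUpTo-lockstep

-- Huffman executions

module HuffmanChains (ℝ : RealNumbers) {m : ℕ} (p : Fin (suc m) → RealNumbers.Carrier ℝ) where
  open RealNumbers ℝ using (_≤ℝ_)
  open Huffman ℝ

  module _ {F : ℕ → Family (suc m)} (h : HuffmanExecution p F) where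
    open HuffmanExecution h

    execution-forest : ∀ k → k ≤ m → Forest (F k)
    execution-forest zero _ = proj₁ (singletons-forest init)
    execution-forest (suc k) k<m with step k k<m
    ... | _ , A , B , mA , mB , A≢B , _ , F≐ =
      proj₁ (forest-adjoin (execution-forest k (<⇒≤ k<m)) mA mB A≢B F≐)

    execution-corresponds : Corresponds m F (MaxIn ∘ F)
    execution-corresponds = record { base = proj₂ (singletons-forest init) ; step = merges }
      where
      merges : ∀ k → k < m → ∃[ C ] ∃[ A ] ∃[ B ]
                 (F (suc k) C × ¬ F k C × MaxIn (F k) A × MaxIn (F k) B × A ≢ B × C ≡ A ∪ B ×
                  MaxIn (F (suc k)) ≐ Merge (MaxIn (F k)) A B)
      merges k k<m with step k k<m
      ... | _ , A , B , mA , mB , A≢B , _ , F≐ =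
        A ∪ B , A , B , proj₂ (F≐ _) (inj₂ refl) , ∪-∉-maxIn mA mB A≢B , mA , mB , A≢B , refl ,
        proj₂ (forest-adjoin (execution-forest k (<⇒≤ k<m)) mA mB A≢B F≐)

    module _ {Π : ℕ → Family (suc m)} (c : Corresponds m F Π) where
      open Corresponds c renaming (base to Π-base; step to Π-step)

      corresponds-lockstep : Lockstep m F Π
      corresponds-lockstep k k<m with Π-step k k<m | step k k<m
      ... | _ , A , B , fA∪B , ¬fA∪B , pA , pB , A≢B , refl , Π≐merge | _ , _ , _ , _ , _ , _ , _ , F≐ =
        A , B , pA , pB , A≢B , Π≐merge ,
        subst (λ C → F (suc k) ≐ Adjoin (F k) C) (sym (adjoined-unique F≐ fA∪B ¬fA∪B)) F≐

      corresponds-roots : ∀ k → k ≤ m → Π k ≐ MaxIn (F k)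
      corresponds-roots k k≤m = proj₂ (lockstep-roots init Π-base corresponds-lockstep k k≤m)

      corresponds-mergeSequence : IsMergeSequence m Π
      corresponds-mergeSequence = record { base = Π-base ; merges = merges }
        where
        merges : ∀ k → k < m → Covers (Π (suc k)) (Π k)
        merges k k<m with corresponds-lockstep k k<m
        ... | A , B , pA , pB , A≢B , Π≐merge , _ = A , B , pA , pB , A≢B , Π≐merge

      corresponds-maximalChain : IsMaximalChain m Π
      corresponds-maximalChain = mergeSequence⇒maximalChain corresponds-mergeSequence
        (proj₂ (corresponds-roots m ≤-refl ⊤) (⊤-maxIn stop))

      -- the class created at step k is the union chosen by the algorithm, whose weight is minimal
      corresponds-huffmanCondition : HuffmanCondition p Π
      corresponds-huffmanCondition k k<m C Πsk-C ¬Πk-C Q _ (A' , B' , pA' , pB' , A'≢B' , Q≐merge) D qD ¬Πk-D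
        with Π-step k k<m | step k k<m
      ... | _ , A , B , fA∪B , ¬fA∪B , _ , _ , _ , refl , Π≐merge | _ , A₀ , B₀ , _ , _ , _ , minimal , F≐ =
        subst₂ (λ U V → weight p U ≤ℝ weight p V) (sym C≡A₀∪B₀) (sym D≡A'∪B')
          (minimal A' B' (root pA') (root pB') A'≢B')
        where
        C≡A₀∪B₀ : C ≡ A₀ ∪ B₀
        C≡A₀∪B₀ = trans (merge-new-class {P = Π k} (proj₁ (Π≐merge C) Πsk-C) ¬Πk-C) (adjoined-unique F≐ fA∪B ¬fA∪B)
        D≡A'∪B' : D ≡ A' ∪ B'
        D≡A'∪B' = merge-new-class {P = Π k} (proj₁ (Q≐merge D) qD) ¬Πk-D
        root : ∀ {X} → Π k X → MaxIn (F k) X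
        root {X} = proj₁ (corresponds-roots k (<⇒≤ k<m) X)

  module _ {Π : ℕ → Family (suc m)} (ms : IsMergeSequence m Π) where

    huffmanCondition⇒execution : ∃[ k ] (k ≤ m × Π k ⊤) → HuffmanCondition p Π →
                                 HuffmanExecution p (ClassesUpTo Π)
    huffmanCondition⇒execution top condition = record
      { init = classesUpTo-base ms ; step = step ; stop = top }
      where
      step : ∀ k → k < m →
             ¬ ClassesUpTo Π k ⊤ × ∃[ A ] ∃[ B ]
               (MaxIn (ClassesUpTo Π k) A × MaxIn (ClassesUpTo Π k) B × A ≢ B ×
                (∀ A' B' → MaxIn (ClassesUpTo Π k) A' → MaxIn (ClassesUpTo Π k) B' → A' ≢ B' →
                   weight p (A ∪ B) ≤ℝ weight p (A' ∪ B')) ×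
                ClassesUpTo Π (suc k) ≐ Adjoin (ClassesUpTo Π k) (A ∪ B))
      step k k<m with classesUpTo-lockstep ms k k<m
      ... | A , B , pA , pB , A≢B , Π≐merge , grows =
        ¬⊤ , A , B , proj₁ (Π≐roots A) pA , proj₁ (Π≐roots B) pB , A≢B , minimal , grows
        where
        π = mergeSequence-partitions ms k (<⇒≤ k<m)
        Π≐roots = classesUpTo-roots ms k (<⇒≤ k<m)
        ¬⊤ : ¬ ClassesUpTo Π k ⊤
        ¬⊤ c⊤ = let Πk⊤ = proj₂ (Π≐roots ⊤) (⊤-maxIn c⊤) in
          A≢B (trans (⊤-class-unique π Πk⊤ pA) (sym (⊤-class-unique π Πk⊤ pB)))
        minimal : ∀ A' B' → MaxIn (ClassesUpTo Π k) A' → MaxIn (ClassesUpTo Π k) B' → A' ≢ B' →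
                  weight p (A ∪ B) ≤ℝ weight p (A' ∪ B')
        minimal A' B' mA' mB' A'≢B' =
          let pA' = proj₂ (Π≐roots A') mA'
              pB' = proj₂ (Π≐roots B') mB'
          in condition k k<m (A ∪ B) (proj₂ (Π≐merge _) (inj₂ refl)) (∪-not-class π pA pB A≢B)
               (Merge (Π k) A' B') (merge-isPartition π pA' pB' A'≢B')
               (A' , B' , pA' , pB' , A'≢B' , λ X → id , id)
               (A' ∪ B') (inj₂ refl) (∪-not-class π pA' pB' A'≢B')

open Huffman

mainTheorem2 : (ℝ : RealNumbers) (m : ℕ) (p : Fin (suc m) → RealNumbers.Carrier ℝ) →
    (∀ i → RealNumbers._≤ℝ_ ℝ (RealNumbers.0# ℝ) (p i)) →
    ((F : ℕ → Family (suc m)) → HuffmanExecution ℝ p F →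
       (∃[ Π ] Corresponds m F Π) ×
       (∀ Π → Corresponds m F Π → IsMaximalChain m Π))
    ×
    ((Π : ℕ → Family (suc m)) → IsMaximalChain m Π →
       ((∃[ F ] (HuffmanExecution ℝ p F × Corresponds m F Π))
         ⇔ HuffmanCondition ℝ p Π))
mainTheorem2 ℝ m p _ =
  (λ F h → (MaxIn ∘ F , execution-corresponds h) , λ Π → corresponds-maximalChain h) ,
  (λ Π mc → (λ (F , h , c) → corresponds-huffmanCondition h c) ,
            λ condition → let ms = maximalChain⇒mergeSequence mc in
              ClassesUpTo Π , huffmanCondition⇒execution ms (maximalChain-top mc) condition ,
              classesUpTo-corresponds ms)
  where open HuffmanChains ℝ p
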